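{- For any graph $G$, $\chi''_a(G)\leq \chi(G)+\chi'(G)$.
   Context: All graphs are finite and simple. For a positive integer $k$, $[k]=\{1,\ldots,k\}$. A proper total $k$-coloring of $G=(V,E)$ is a map $f:V\cup E\to[k]$ such that adjacent vertices get different colors, adjacent edges get different colors, and each edge gets a color different from the colors of its two endvertices. The color set of a vertex $v$ under $f$ is $C_f(v)=\{f(v)\}\cup\{f(vu): vu\in E\}$. An adjacent vertex distinguishing (avd) total $k$-coloring is a proper total $k$-coloring with $C_f(u)\neq C_f(v)$ for every edge $uv\in E$; $\chi''_a(G)$ is the least $k$ for which one exists. $\chi(G)$ is the chromatic number and $\chi'(G)$ the chromatic index of $G$. -}

module Defs where

open import Data.Nat using (ℕ; _≤_)
open import Data.Fin using (Fin)
open import Data.Bool using (Bool; true; false)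
open import Data.Product using (Σ; ∃; _×_)
open import Data.Sum using (_⊎_)
open import Relation.Binary.PropositionalEquality using (_≡_; _≢_)
open import Relation.Nullary using (¬_)
open import Function.Bundles using (_⇔_)

record Graph : Set where
  field
    n      : ℕ
    adj    : Fin n → Fin n → Bool
    adj-sym    : ∀ u v → adj u v ≡ adj v u
    adj-irrefl : ∀ v → adj v v ≡ false

open Graph public

Vertex : Graph → Set
Vertex G = Fin (n G)

Edge? : (G : Graph) → Vertex G → Vertex G → Set
Edge? G u v = adj G u v ≡ true

-- Colours are Fin k (i.e. [k] shifted by one).
-- Vertex colouring: a map on vertices.
VColouring : Graph → ℕ → Set
VColouring G k = Vertex G → Fin k

-- Edge colouring: a map on ordered pairs; only its values on edges matter,
-- and it must be symmetric on edges (so it is a map on the edge set).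
EColouring : Graph → ℕ → Set
EColouring G k = Vertex G → Vertex G → Fin k

IsProperVColouring : (G : Graph) (k : ℕ) → VColouring G k → Set
IsProperVColouring G k c = ∀ u v → Edge? G u v → c u ≢ c v

IsEdgeMap : (G : Graph) (k : ℕ) → EColouring G k → Set
IsEdgeMap G k f = ∀ u v → Edge? G u v → f u v ≡ f v u

IsProperEColouring : (G : Graph) (k : ℕ) → EColouring G k → Set
IsProperEColouring G k f =
  IsEdgeMap G k f ×
  (∀ u v w → Edge? G u v → Edge? G u w → v ≢ w → f u v ≢ f u w)

IsProperTotalColouring : (G : Graph) (k : ℕ) → VColouring G k → EColouring G k → Set
IsProperTotalColouring G k fv fe =
  IsProperVColouring G k fv ×
  IsProperEColouring G k fe ×
  (∀ u v → Edge? G u v → fe u v ≢ fv u)   -- by symmetry also ≢ fv v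

_∈C[_,_,_]_ : ∀ {G k} → Fin k → VColouring G k → EColouring G k → Vertex G → Set
_∈C[_,_,_]_ {G} c fv fe v = (c ≡ fv v) ⊎ (Σ (Vertex G) λ u → Edge? G v u × fe v u ≡ c)

IsAVDTotalColouring : (G : Graph) (k : ℕ) → VColouring G k → EColouring G k → Set
IsAVDTotalColouring G k fv fe =
  IsProperTotalColouring G k fv fe ×
  (∀ u v → Edge? G u v → ¬ (∀ c → (_∈C[_,_,_]_ {G} c fv fe u) ⇔ (_∈C[_,_,_]_ {G} c fv fe v)))

VColourable : Graph → ℕ → Set
VColourable G k = Σ (VColouring G k) (IsProperVColouring G k)

EColourable : Graph → ℕ → Set
EColourable G k = Σ (EColouring G k) (IsProperEColouring G k)

AVDTotalColourable : Graph → ℕ → Set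
AVDTotalColourable G k = Σ (VColouring G k) λ fv → Σ (EColouring G k) λ fe → IsAVDTotalColouring G k fv fe

IsLeast : (ℕ → Set) → ℕ → Set
IsLeast P m = P m × (∀ j → P j → m ≤ j)

IsChromaticNumber : Graph → ℕ → Set
IsChromaticNumber G = IsLeast (VColourable G)

IsChromaticIndex : Graph → ℕ → Set
IsChromaticIndex G = IsLeast (EColourable G)

IsAVDTotalChromaticNumber : Graph → ℕ → Set
IsAVDTotalChromaticNumber G = IsLeast (AVDTotalColourable G)

{-# OPTIONS --safe #-}
-- Colour the vertices with a proper χ(G)-colouring and the edges with a
-- proper χ'(G)-colouring drawn from a disjoint palette. The result is a
-- proper total colouring, and it is adjacent vertex distinguishing because
-- the only vertex colour in C(v) is the colour of v itself, so the colour of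
-- u lies in C(u) but not in C(v) whenever u and v are adjacent.
module Submission where

open import Defs
open import Data.Nat using (ℕ; _≤_; _+_)
open import Data.Fin using (Fin; _↑ˡ_; _↑ʳ_; splitAt)
open import Data.Fin.Properties using (↑ˡ-injective; ↑ʳ-injective; splitAt-↑ˡ; splitAt-↑ʳ)
open import Data.Sum using (inj₁; inj₂)
open import Data.Product using (_,_)
open import Relation.Binary.PropositionalEquality using (_≡_; _≢_; refl; sym; trans; cong)
open import Function.Bundles using (_⇔_; Equivalence)
open import Relation.Nullary using (¬_)

↑ʳ≢↑ˡ : ∀ {m n} (i : Fin m) (j : Fin n) → m ↑ʳ j ≢ i ↑ˡ n
↑ʳ≢↑ˡ {m} {n} i j eq
  with trans (sym (splitAt-↑ʳ m n j)) (trans (cong (splitAt m) eq) (splitAt-↑ˡ m i n))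
... | ()

module DisjointPalettes (G : Graph) {a b : ℕ} (cv : VColouring G a) (ce : EColouring G b) where

  fv : VColouring G (a + b)
  fv v = cv v ↑ˡ b

  fe : EColouring G (a + b)
  fe u v = a ↑ʳ ce u v

  vertexColour∈C⇒≡ : ∀ u v → _∈C[_,_,_]_ {G} (fv u) fv fe v → cv u ≡ cv v
  vertexColour∈C⇒≡ u v (inj₁ eq)          = ↑ˡ-injective b _ _ eq
  vertexColour∈C⇒≡ u v (inj₂ (w , _ , eq)) with ↑ʳ≢↑ˡ (cv u) (ce v w) eq
  ... | ()

  isAVDTotalColouring : IsProperVColouring G a cv → IsProperEColouring G b ce →
                        IsAVDTotalColouring G (a + b) fv fe
  isAVDTotalColouring pv (ce-sym , pe) = (properV , (fe-sym , properE) , fe≢fv) , distinguishing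
    where
    properV : IsProperVColouring G (a + b) fv
    properV u v uv eq = pv u v uv (↑ˡ-injective b _ _ eq)

    fe-sym : IsEdgeMap G (a + b) fe
    fe-sym u v uv = cong (a ↑ʳ_) (ce-sym u v uv)

    properE : ∀ u v w → Edge? G u v → Edge? G u w → v ≢ w → fe u v ≢ fe u w
    properE u v w uv uw v≢w eq = pe u v w uv uw v≢w (↑ʳ-injective a _ _ eq)

    fe≢fv : ∀ u v → Edge? G u v → fe u v ≢ fv u
    fe≢fv u v _ = ↑ʳ≢↑ˡ (cv u) (ce u v)

    distinguishing : ∀ u v → Edge? G u v →
                     ¬ (∀ c → (_∈C[_,_,_]_ {G} c fv fe u) ⇔ (_∈C[_,_,_]_ {G} c fv fe v))
    distinguishing u v uv sameC =
      pv u v uv (vertexColour∈C⇒≡ u v (Equivalence.to (sameC (fv u)) (inj₁ refl)))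

avdTotalColourable-+ : (G : Graph) {a b : ℕ} → VColourable G a → EColourable G b →
                       AVDTotalColourable G (a + b)
avdTotalColourable-+ G (cv , pv) (ce , pe) = fv , fe , isAVDTotalColouring pv pe
  where open DisjointPalettes G cv ce

proposition1 : (G : Graph) (a b c : ℕ) → IsChromaticNumber G a → IsChromaticIndex G b → IsAVDTotalChromaticNumber G c → c ≤ a + b
proposition1 G a b c (va , _) (eb , _) (_ , least) = least (a + b) (avdTotalColourable-+ G va eb)
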